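{- A clique $a$ in an edge-colored complete graph is a tree $2$-clique if and only if it is a hereditary $2$-clique.
   Context: A clique is a complete subgraph induced by a nonempty vertex set, with the restricted edge coloring. A partition of a clique $a$ into nonempty disjoint subcliques is a $\Delta$-partition ($\Delta$ a set of colors) if every edge joining vertices in different blocks has color in $\Delta$; it is a $2$-partition if it is a $\Delta$-partition for some $\Delta$ with $|\Delta|\le 2$; it is homogeneous if for any two distinct blocks $a_1,a_2$ all edges between $a_1$ and $a_2$ have the same color. Hereditary $2$-cliques are defined inductively (least class): every singleton clique is one, and if a clique admits a homogeneous $2$-partition whose blocks are hereditary $2$-cliques, then it is a hereditary $2$-clique. A tree is a finite poset in which every pair of unrelated elements has a common upper bound but no common lower bound; parent/child means covering relation, siblings are unrelated elements with a common parent, leaves are elements with no children. The sibling graph $S(T)$ has vertex set $T$ and edges between siblings; a coloring $\widehat{\bullet}$ of $S(T)$ is a $2$-coloring if for each non-leaf $t$ the edges among children of $t$ use at most two colors. The leaf graph $K(T)$ is the complete graph on the leaves, colored by $\overline{st}=\widehat{uv}$ with $u,v$ the siblings such that $s\le u$, $t\le v$. A clique $a$ is a tree $2$-clique if there are a tree $T$, a $2$-coloring of $S(T)$ and a color-preserving bijection from $a$ onto $K(T)$. -}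

module Defs where

open import Data.Nat using (ℕ; _≤_)
open import Data.Fin using (Fin)
open import Data.Fin.Subset using (Subset; _∈_; _⊆_; Nonempty; ⁅_⁆)
open import Data.Bool using (Bool; T)
open import Data.List using (List; length)
open import Data.List.Membership.Propositional renaming (_∈_ to _∈L_)
open import Data.Product using (Σ; ∃; _×_)
open import Relation.Binary.PropositionalEquality using (_≡_; _≢_)
open import Relation.Nullary using (¬_)

-- Edge-colored complete graph: vertex set Fin n, colors in C,
-- a symmetric coloring col (only values on distinct vertices matter).

Symmetric : ∀ {n} {C : Set} → (Fin n → Fin n → C) → Set
Symmetric {n} col = ∀ (x y : Fin n) → col x y ≡ col y x

record IsPartition {n k : ℕ} (a : Subset n) (B : Fin k → Subset n) : Set where
  field
    nonempty : ∀ i → Nonempty (B i)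
    sub      : ∀ i → B i ⊆ a
    cover    : ∀ {x} → x ∈ a → ∃ λ i → x ∈ B i
    disjoint : ∀ {i j x} → x ∈ B i → x ∈ B j → i ≡ j

IsΔPartition : ∀ {n k} {C : Set} → (Fin n → Fin n → C) → List C →
               (Fin k → Subset n) → Set
IsΔPartition col Δ B =
  ∀ i j x y → i ≢ j → x ∈ B i → y ∈ B j → col x y ∈L Δ

Is2Partition : ∀ {n k} {C : Set} → (Fin n → Fin n → C) →
               (Fin k → Subset n) → Set
Is2Partition {C = C} col B =
  Σ (List C) λ Δ → length Δ ≤ 2 × IsΔPartition col Δ B

IsHomogeneous : ∀ {n k} {C : Set} → (Fin n → Fin n → C) →
                (Fin k → Subset n) → Set
IsHomogeneous col B =
  ∀ i j x x′ y y′ → i ≢ j → x ∈ B i → x′ ∈ B i → y ∈ B j → y′ ∈ B j →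
  col x y ≡ col x′ y′

data Hereditary2Clique {n : ℕ} {C : Set} (col : Fin n → Fin n → C)
     : Subset n → Set where
  singleton : ∀ x → Hereditary2Clique col ⁅ x ⁆
  split     : ∀ (a : Subset n) (k : ℕ) (B : Fin k → Subset n) →
              Nonempty a →
              IsPartition a B →
              IsHomogeneous col B →
              Is2Partition col B →
              (∀ i → Hereditary2Clique col (B i)) →
              Hereditary2Clique col a

-- Trees: finite posets, carrier Fin m, order given by a (Boolean-valued,
-- i.e. decidable) relation le; s ≤ t means T (le s t).

module TreeNotions {m : ℕ} (le : Fin m → Fin m → Bool) where

  _≼_ : Fin m → Fin m → Set
  s ≼ t = T (le s t)

  _≺_ : Fin m → Fin m → Set
  s ≺ t = s ≼ t × s ≢ t

  Unrelated : Fin m → Fin m → Set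
  Unrelated s t = ¬ (s ≼ t) × ¬ (t ≼ s)

  record IsTree : Set where
    field
      refl′    : ∀ s → s ≼ s
      antisym  : ∀ s t → s ≼ t → t ≼ s → s ≡ t
      trans′   : ∀ s t u → s ≼ t → t ≼ u → s ≼ u
      upper    : ∀ s t → Unrelated s t → ∃ λ u → s ≼ u × t ≼ u
      noLower  : ∀ s t → Unrelated s t → ¬ (∃ λ u → u ≼ s × u ≼ t)

  Child : Fin m → Fin m → Set
  Child t p = t ≺ p × (∀ s → ¬ (t ≺ s × s ≺ p))

  Sibling : Fin m → Fin m → Set
  Sibling u v = Unrelated u v × ∃ λ p → Child u p × Child v p

  Leaf : Fin m → Set
  Leaf t = ∀ s → ¬ Child s t

  record Is2Coloring {C : Set} (hat : Fin m → Fin m → C) : Set where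
    field
      symm : ∀ u v → Sibling u v → hat u v ≡ hat v u
      two  : ∀ t → ¬ Leaf t →
             Σ (List C) λ Δ → length Δ ≤ 2 ×
               (∀ u v → Child u t → Child v t → u ≢ v → hat u v ∈L Δ)

  -- Color of the leaf graph K(T): overline{st} = hat u v for the siblings
  -- u, v with s ≤ u and t ≤ v.  "c is the color of st in K(T)":
  LeafColor : {C : Set} → (Fin m → Fin m → C) → Fin m → Fin m → C → Set
  LeafColor hat s t c = ∀ u v → Sibling u v → s ≼ u → t ≼ v → c ≡ hat u v

open TreeNotions public

record Tree2Witness {n : ℕ} {C : Set} (col : Fin n → Fin n → C)
       (a : Subset n) (m : ℕ) (le : Fin m → Fin m → Bool)
       (hat : Fin m → Fin m → C) (φ : Fin n → Fin m) : Set where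
  field
    isTree     : IsTree le
    is2Col     : Is2Coloring le hat
    toLeaf     : ∀ x → x ∈ a → Leaf le (φ x)
    injective  : ∀ x y → x ∈ a → y ∈ a → φ x ≡ φ y → x ≡ y
    surjective : ∀ t → Leaf le t → ∃ λ x → x ∈ a × φ x ≡ t
    preserves  : ∀ x y → x ∈ a → y ∈ a → x ≢ y →
                 LeafColor le hat (φ x) (φ y) (col x y)

Tree2Clique : ∀ {n} {C : Set} → (Fin n → Fin n → C) → Subset n → Set
Tree2Clique {n} {C} col a =
  Σ ℕ λ m → Σ (Fin m → Fin m → Bool) λ le → Σ (Fin m → Fin m → C) λ hat →
  Σ (Fin n → Fin m) λ φ → Tree2Witness col a m le hat φ

-- A tree 2-clique is hereditary: below every node t of the tree lie the vertices whose
-- leaves are ≤ t, and the children of t split them into blocks; siblings u, v colour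
-- every edge between their blocks by hat u v, so the split is homogeneous, and it is a
-- 2-partition because the children of t use at most two colours.  Well-founded
-- induction on the tree then gives the hereditary structure, starting from the root.
--
-- Conversely, unfolding a hereditary derivation collects its cliques into a laminar
-- family containing a and all singletons, in which the maximal proper members of each
-- member are exactly the blocks of a homogeneous 2-partition.  Ordered by inclusion,
-- such a family is a tree whose leaves are the singletons, coloured by the colours
-- between blocks.
module Submission where

open import Data.Bool using (Bool)
import Data.Bool.Properties as Bool
open import Data.Empty using (⊥; ⊥-elim)
open import Data.Fin using (Fin; zero; suc)
open import Data.Fin.Induction using (spo-wellFounded; spo-noetherian)
open import Data.Fin.Properties using (any?; all?) renaming (_≟_ to _≟F_)
open import Data.Fin.Subset using (Subset; _∈_; _⊆_; Nonempty; ⁅_⁆)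
open import Data.Fin.Subset.Properties using (_∈?_; _⊆?_; ⊆-antisym; x∈⁅x⁆; x∈⁅y⁆⇒x≡y)
open import Data.List using (List; []; _∷_; length; lookup; filter; allFin; concat; tabulate; deduplicate)
open import Data.List.Membership.Propositional renaming (_∈_ to _∈L_)
open import Data.List.Membership.Propositional.Properties
  using (∈-lookup; ∈-filter⁺; ∈-filter⁻; ∈-allFin; ∈-tabulate⁺; ∈-tabulate⁻;
         ∈-concat⁺′; ∈-concat⁻′; ∈-deduplicate⁺; ∈-deduplicate⁻)
open import Data.List.Relation.Unary.All as All using (All; []; _∷_)
open import Data.List.Relation.Unary.AllPairs using (_∷_)
open import Data.List.Relation.Unary.Any using (here; there; index)
open import Data.List.Relation.Unary.Any.Properties using (lookup-index)
open import Data.List.Relation.Unary.Unique.DecPropositional.Properties using (deduplicate-!)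
open import Data.List.Relation.Unary.Unique.Propositional using (Unique)
open import Data.List.Relation.Unary.Unique.Propositional.Properties using (allFin⁺; filter⁺)
open import Data.Nat using (ℕ; _≤_; z≤n)
open import Data.Product using (Σ; ∃; _×_; _,_; proj₁; proj₂)
open import Data.Sum using (_⊎_; inj₁; inj₂)
import Data.Vec as Vec
open import Data.Vec.Properties using (lookup⇒[]=; []=⇒lookup; lookup∘tabulate; ≡-dec)
open import Defs hiding (_≼_; _≺_; Unrelated; IsTree; Child; Sibling; Leaf; Is2Coloring; LeafColor)
open import Induction.WellFounded using (Acc; acc; WellFounded)
open import Relation.Binary.PropositionalEquality
open import Relation.Binary.Structures using (IsStrictPartialOrder)
open import Relation.Nullary using (Dec; yes; no; does; ¬_)
open import Relation.Nullary.Decidable using (_×-dec_; ¬?; map′; dec-true; isYes; toWitness; fromWitness)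

Unique⇒lookup-injective : ∀ {A : Set} {xs : List A} → Unique xs →
                          ∀ {i j} → lookup xs i ≡ lookup xs j → i ≡ j
Unique⇒lookup-injective (_ ∷ _) {zero} {zero} _ = refl
Unique⇒lookup-injective (x∉xs ∷ _) {zero} {suc j} eq = ⊥-elim (All.lookup x∉xs (∈-lookup j) eq)
Unique⇒lookup-injective (x∉xs ∷ _) {suc i} {zero} eq = ⊥-elim (All.lookup x∉xs (∈-lookup i) (sym eq))
Unique⇒lookup-injective (_ ∷ xs!) {suc i} {suc j} eq = cong suc (Unique⇒lookup-injective xs! eq)

select : ∀ {n} {P : Fin n → Set} → (∀ x → Dec (P x)) → Subset n
select P? = Vec.tabulate (λ x → does (P? x))

∈-select⁺ : ∀ {n} {P : Fin n → Set} (P? : ∀ x → Dec (P x)) {x} → P x → x ∈ select P?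
∈-select⁺ P? {x} px = lookup⇒[]= x (select P?) (trans (lookup∘tabulate _ x) (dec-true (P? x) px))

∈-select⁻ : ∀ {n} {P : Fin n → Set} (P? : ∀ x → Dec (P x)) {x} → x ∈ select P? → P x
∈-select⁻ P? {x} x∈ with P? x | trans (sym (lookup∘tabulate (λ x → does (P? x)) x)) ([]=⇒lookup x∈)
... | yes px | _ = px
... | no _   | ()

module TreeProperties {m : ℕ} {le : Fin m → Fin m → Bool} (isTree : TreeNotions.IsTree le) where
  open TreeNotions le
  open IsTree isTree

  _≼?_ : ∀ s t → Dec (s ≼ t)
  s ≼? t = Bool.T? (le s t)

  _≺?_ : ∀ s t → Dec (s ≺ t)
  s ≺? t = (s ≼? t) ×-dec ¬? (s ≟F t)

  ≼-≺-trans : ∀ {s t u} → s ≼ t → t ≺ u → s ≺ u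
  ≼-≺-trans {s} {t} {u} s≼t (t≼u , t≢u) =
    trans′ s t u s≼t t≼u , λ { refl → t≢u (antisym t s t≼u s≼t) }

  ≺-isStrictPartialOrder : IsStrictPartialOrder _≡_ _≺_
  ≺-isStrictPartialOrder = record
    { isEquivalence = isEquivalence
    ; irrefl = λ { refl (_ , s≢s) → s≢s refl }
    ; trans = λ s≺t → ≼-≺-trans (proj₁ s≺t)
    ; <-resp-≈ = (λ { refl p → p }) , (λ { refl p → p })
    }

  ≺-wellFounded : WellFounded _≺_
  ≺-wellFounded = spo-wellFounded ≺-isStrictPartialOrder

  ≻-wellFounded : WellFounded (λ s t → t ≺ s)
  ≻-wellFounded = spo-noetherian ≺-isStrictPartialOrder

  child? : ∀ s t → Dec (Child s t)
  child? s t = (s ≺? t) ×-dec all? (λ u → ¬? ((s ≺? u) ×-dec (u ≺? t)))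

  leaf? : ∀ t → Dec (Leaf t)
  leaf? t = map′ (λ ¬child s s-child → ¬child (s , s-child)) (λ leaf (s , s-child) → leaf s s-child)
                 (¬? (any? (λ s → child? s t)))

  ≺⇒≼-child : ∀ {s t} → s ≺ t → ∃ λ c → Child c t × s ≼ c
  ≺⇒≼-child = go (≻-wellFounded _)
    where
    go : ∀ {s t} → Acc (λ s t → t ≺ s) s → s ≺ t → ∃ λ c → Child c t × s ≼ c
    go {s} {t} (acc rs) s≺t with any? (λ u → (s ≺? u) ×-dec (u ≺? t))
    ... | yes (u , s≺u , u≺t) = let (c , c-child , u≼c) = go (rs s≺u) u≺t
                                in c , c-child , trans′ s u c (proj₁ s≺u) u≼c
    ... | no ¬between = s , (s≺t , λ u s≺u≺t → ¬between (u , s≺u≺t)) , refl′ s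

  leaf-minimal : ∀ {s t} → Leaf t → ¬ (s ≺ t)
  leaf-minimal t-leaf s≺t = let (c , c-child , _) = ≺⇒≼-child s≺t in t-leaf c c-child

  leaf-below : ∀ t → ∃ λ l → Leaf l × l ≼ t
  leaf-below t = go (≺-wellFounded t)
    where
    go : ∀ {t} → Acc _≺_ t → ∃ λ l → Leaf l × l ≼ t
    go {t} (acc rs) with any? (λ s → child? s t)
    ... | yes (s , s-child) = let (l , l-leaf , l≼s) = go (rs (proj₁ s-child))
                              in l , l-leaf , trans′ l s t l≼s (proj₁ (proj₁ s-child))
    ... | no ¬child = t , (λ s s-child → ¬child (s , s-child)) , refl′ t

  upper-bound₂ : ∀ s t → ∃ λ u → s ≼ u × t ≼ u
  upper-bound₂ s t with s ≼? t | t ≼? s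
  ... | yes s≼t | _       = t , s≼t , refl′ t
  ... | no _    | yes t≼s = s , refl′ s , t≼s
  ... | no s⋠t  | no t⋠s  = upper s t (s⋠t , t⋠s)

  upper-bound : Fin m → ∀ xs → ∃ λ r → All (_≼ r) xs
  upper-bound r₀ [] = r₀ , []
  upper-bound r₀ (x ∷ xs) =
    let (r , xs≼r) = upper-bound r₀ xs
        (u , x≼u , r≼u) = upper-bound₂ x r
    in u , x≼u ∷ All.map (λ {s} s≼r → trans′ s r u s≼r r≼u) xs≼r

  greatest : Fin m → ∃ λ r → ∀ s → s ≼ r
  greatest r₀ = let (r , all≼r) = upper-bound r₀ (allFin m)
                in r , λ s → All.lookup all≼r (∈-allFin s)

  children⇒sibling : ∀ {u v p} → Child u p → Child v p → u ≢ v → Sibling u v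
  children⇒sibling {u} {v} {p} u-child v-child u≢v =
    ( (λ u≼v → proj₂ u-child v ((u≼v , u≢v) , proj₁ v-child))
    , (λ v≼u → proj₂ v-child u ((v≼u , λ v≡u → u≢v (sym v≡u)) , proj₁ u-child)) )
    , p , u-child , v-child

module TreeToHereditary {n : ℕ} {C : Set} {col : Fin n → Fin n → C} {a : Subset n}
         {m : ℕ} {le : Fin m → Fin m → Bool} {hat : Fin m → Fin m → C} {φ : Fin n → Fin m}
         (W : Tree2Witness col a m le hat φ) where
  open Tree2Witness W
  open TreeNotions le
  open IsTree isTree
  open TreeProperties isTree

  Below : Fin m → Subset n
  Below t = select (λ x → (x ∈? a) ×-dec (φ x ≼? t))

  ∈-Below⁺ : ∀ {x t} → x ∈ a → φ x ≼ t → x ∈ Below t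
  ∈-Below⁺ x∈a φx≼t = ∈-select⁺ (λ x → (x ∈? a) ×-dec (φ x ≼? _)) (x∈a , φx≼t)

  ∈-Below⁻ : ∀ {x t} → x ∈ Below t → x ∈ a × φ x ≼ t
  ∈-Below⁻ = ∈-select⁻ (λ x → (x ∈? a) ×-dec (φ x ≼? _))

  Below-mono : ∀ {s t} → s ≼ t → Below s ⊆ Below t
  Below-mono {s} {t} s≼t {x} x∈ =
    let (x∈a , φx≼s) = ∈-Below⁻ x∈ in ∈-Below⁺ x∈a (trans′ (φ x) s t φx≼s s≼t)

  Below-nonempty : ∀ t → Nonempty (Below t)
  Below-nonempty t with leaf-below t
  ... | l , l-leaf , l≼t with surjective l l-leaf
  ...   | x , x∈a , refl = x , ∈-Below⁺ x∈a l≼t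

  Below-leaf : ∀ {t} → Leaf t → ∃ λ x → Below t ≡ ⁅ x ⁆
  Below-leaf {t} t-leaf with surjective t t-leaf
  ... | x , x∈a , refl = x , ⊆-antisym Below⊆⁅x⁆ ⁅x⁆⊆Below
    where
    ⁅x⁆⊆Below : ⁅ x ⁆ ⊆ Below (φ x)
    ⁅x⁆⊆Below y∈⁅x⁆ = subst (_∈ Below (φ x)) (sym (x∈⁅y⁆⇒x≡y _ y∈⁅x⁆)) (∈-Below⁺ x∈a (refl′ (φ x)))

    Below⊆⁅x⁆ : Below (φ x) ⊆ ⁅ x ⁆
    Below⊆⁅x⁆ {y} y∈ with ∈-Below⁻ y∈ | φ y ≟F φ x
    ... | y∈a , _ | yes φy≡φx = subst (_∈ ⁅ x ⁆) (sym (injective y x y∈a x∈a φy≡φx)) (x∈⁅x⁆ x)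
    ... | _ , φy≼φx | no φy≢φx = ⊥-elim (leaf-minimal t-leaf (φy≼φx , φy≢φx))

  Below-greatest : ∀ {r} → (∀ s → s ≼ r) → Below r ≡ a
  Below-greatest all≼r = ⊆-antisym (λ x∈ → proj₁ (∈-Below⁻ x∈)) (λ {x} x∈a → ∈-Below⁺ x∈a (all≼r (φ x)))

  Below-disjoint : ∀ {s t x} → Unrelated s t → x ∈ Below s → x ∈ Below t → ⊥
  Below-disjoint {s} {t} {x} s⋈t x∈s x∈t =
    noLower s t s⋈t (φ x , proj₂ (∈-Below⁻ x∈s) , proj₂ (∈-Below⁻ x∈t))

  col≡hat : ∀ {u v x y} → Sibling u v → x ∈ Below u → y ∈ Below v → col x y ≡ hat u v
  col≡hat {u} {v} {x} {y} sib x∈u y∈v =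
    let (x∈a , φx≼u) = ∈-Below⁻ x∈u
        (y∈a , φy≼v) = ∈-Below⁻ y∈v
        x≢y = λ { refl → Below-disjoint (proj₁ sib) x∈u y∈v }
    in preserves x y x∈a y∈a x≢y u v sib φx≼u φy≼v

  module Children (t : Fin m) where
    children : List (Fin m)
    children = filter (λ c → child? c t) (allFin m)

    child : Fin (length children) → Fin m
    child = lookup children

    child-isChild : ∀ i → Child (child i) t
    child-isChild i = proj₂ (∈-filter⁻ (λ c → child? c t) {xs = allFin m} (∈-lookup i))

    child-injective : ∀ {i j} → child i ≡ child j → i ≡ j
    child-injective = Unique⇒lookup-injective (filter⁺ (λ c → child? c t) (allFin⁺ m))

    child-≢ : ∀ {i j} → i ≢ j → child i ≢ child j
    child-≢ i≢j eq = i≢j (child-injective eq)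

    child-sibling : ∀ {i j} → i ≢ j → Sibling (child i) (child j)
    child-sibling i≢j = children⇒sibling (child-isChild _) (child-isChild _) (child-≢ i≢j)

    blocks : Fin (length children) → Subset n
    blocks i = Below (child i)

    ∈-blocks : ∀ {x c} → Child c t → x ∈ Below c → ∃ λ i → x ∈ blocks i
    ∈-blocks {x} {c} c-child x∈c =
      let c∈children = ∈-filter⁺ (λ c → child? c t) (∈-allFin c) c-child
      in index c∈children , subst (λ c → x ∈ Below c) (lookup-index c∈children) x∈c

    blocks-disjoint : ∀ {i j x} → x ∈ blocks i → x ∈ blocks j → i ≡ j
    blocks-disjoint {i} {j} x∈i x∈j with i ≟F j
    ... | yes i≡j = i≡j
    ... | no i≢j = ⊥-elim (Below-disjoint (proj₁ (child-sibling i≢j)) x∈i x∈j)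

    -- For x below t, φ x ≠ t since φ x is a leaf and t is not, so some child of t lies above φ x.
    blocks-partition : ¬ Leaf t → IsPartition (Below t) blocks
    blocks-partition t-nonleaf = record
      { nonempty = λ i → Below-nonempty (child i)
      ; sub = λ i → Below-mono (proj₁ (proj₁ (child-isChild i)))
      ; cover = cover
      ; disjoint = blocks-disjoint
      }
      where
      cover : ∀ {x} → x ∈ Below t → ∃ λ i → x ∈ blocks i
      cover {x} x∈t with ∈-Below⁻ x∈t | φ x ≟F t
      ... | x∈a , _ | yes refl = ⊥-elim (t-nonleaf (toLeaf x x∈a))
      ... | x∈a , φx≼t | no φx≢t =
        let (c , c-child , φx≼c) = ≺⇒≼-child (φx≼t , φx≢t)
        in ∈-blocks c-child (∈-Below⁺ x∈a φx≼c)

    col≡hat-blocks : ∀ {i j x y} → i ≢ j → x ∈ blocks i → y ∈ blocks j →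
                     col x y ≡ hat (child i) (child j)
    col≡hat-blocks i≢j = col≡hat (child-sibling i≢j)

    blocks-homogeneous : IsHomogeneous col blocks
    blocks-homogeneous i j x x′ y y′ i≢j x∈i x′∈i y∈j y′∈j =
      trans (col≡hat-blocks i≢j x∈i y∈j) (sym (col≡hat-blocks i≢j x′∈i y′∈j))

    blocks-2partition : ¬ Leaf t → Is2Partition col blocks
    blocks-2partition t-nonleaf =
      let (Δ , ∣Δ∣≤2 , hat∈Δ) = Is2Coloring.two is2Col t t-nonleaf
      in Δ , ∣Δ∣≤2 , λ i j x y i≢j x∈i y∈j →
           subst (_∈L Δ) (sym (col≡hat-blocks i≢j x∈i y∈j))
                 (hat∈Δ (child i) (child j) (child-isChild i) (child-isChild j) (child-≢ i≢j))

  Below-hereditary : ∀ t → Hereditary2Clique col (Below t)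
  Below-hereditary t = go (≺-wellFounded t)
    where
    go : ∀ {t} → Acc _≺_ t → Hereditary2Clique col (Below t)
    go {t} (acc rs) with leaf? t
    ... | yes t-leaf = let (x , Below≡⁅x⁆) = Below-leaf t-leaf
                       in subst (Hereditary2Clique col) (sym Below≡⁅x⁆) (singleton x)
    ... | no t-nonleaf =
      split (Below t) _ blocks (Below-nonempty t) (blocks-partition t-nonleaf) blocks-homogeneous
            (blocks-2partition t-nonleaf) (λ i → go (rs (proj₁ (child-isChild i))))
      where open Children t

  hereditary : Nonempty a → Hereditary2Clique col a
  hereditary (x , _) = let (r , all≼r) = greatest (φ x)
                       in subst (Hereditary2Clique col) (Below-greatest all≼r) (Below-hereditary r)

_≟S_ : ∀ {n} → (X Y : Subset n) → Dec (X ≡ Y)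
_≟S_ = ≡-dec Bool._≟_

_⊊_ : ∀ {n} → Subset n → Subset n → Set
X ⊊ Y = X ⊆ Y × X ≢ Y

Disjoint : ∀ {n} → Subset n → Subset n → Set
Disjoint X Y = ∀ {x} → x ∈ X → x ∈ Y → ⊥

module Hierarchies {n : ℕ} {C : Set} (col : Fin n → Fin n → C) where

  Covers : List (Subset n) → Subset n → Subset n → Set
  Covers F U P = U ∈L F × P ∈L F × U ⊊ P × (∀ Z → Z ∈L F → ¬ (U ⊊ Z × Z ⊊ P))

  ChildrenColored : List (Subset n) → Subset n → Set
  ChildrenColored F P =
    Σ (List C) λ Δ → length Δ ≤ 2 ×
      (∀ {U V} → Covers F U P → Covers F V P → U ≢ V →
       Σ C λ c → c ∈L Δ × (∀ {x y} → x ∈ U → y ∈ V → col x y ≡ c))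

  record Hierarchy (a : Subset n) (F : List (Subset n)) : Set where
    field
      nonempty         : ∀ {X} → X ∈L F → Nonempty X
      ⊆-top            : ∀ {X} → X ∈L F → X ⊆ a
      top∈             : a ∈L F
      singleton∈       : ∀ {x} → x ∈ a → ⁅ x ⁆ ∈L F
      laminar          : ∀ {X Y} → X ∈L F → Y ∈L F → X ⊆ Y ⊎ Y ⊆ X ⊎ Disjoint X Y
      children-colored : ∀ {P} → P ∈L F → ChildrenColored F P

  hierarchy-singleton : ∀ x → Hierarchy ⁅ x ⁆ (⁅ x ⁆ ∷ [])
  hierarchy-singleton x = record
    { nonempty = λ { (here refl) → x , x∈⁅x⁆ x }
    ; ⊆-top = λ { (here refl) y∈ → y∈ }
    ; top∈ = here refl
    ; singleton∈ = λ y∈⁅x⁆ → subst (λ z → ⁅ z ⁆ ∈L (⁅ x ⁆ ∷ [])) (sym (x∈⁅y⁆⇒x≡y _ y∈⁅x⁆)) (here refl)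
    ; laminar = λ { (here refl) (here refl) → inj₁ (λ y∈ → y∈) }
    ; children-colored = λ _ → [] , z≤n , λ { (here refl , here refl , (_ , U≢U) , _) → ⊥-elim (U≢U refl) }
    }

  -- B≢a: a one-block split with B 0 = a is skipped by hereditary⇒hierarchy, since a
  -- would not cover its own block.
  module Split (a : Subset n) (k : ℕ) (B : Fin k → Subset n) (a-nonempty : Nonempty a)
               (B-partition : IsPartition a B) (B-homogeneous : IsHomogeneous col B)
               (B-2partition : Is2Partition col B)
               (Fs : Fin k → List (Subset n)) (Fs-hierarchy : ∀ i → Hierarchy (B i) (Fs i))
               (B≢a : ∀ i → B i ≢ a) where
    module H i = Hierarchy (Fs-hierarchy i)
    open IsPartition B-partition

    F : List (Subset n)
    F = a ∷ concat (tabulate Fs)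

    ∈F⁺ : ∀ {i Z} → Z ∈L Fs i → Z ∈L F
    ∈F⁺ {i} Z∈ = there (∈-concat⁺′ Z∈ (∈-tabulate⁺ i))

    ∈F⁻ : ∀ {Z} → Z ∈L F → Z ≡ a ⊎ ∃ λ i → Z ∈L Fs i
    ∈F⁻ (here Z≡a) = inj₁ Z≡a
    ∈F⁻ (there Z∈) with ∈-concat⁻′ (tabulate Fs) Z∈
    ... | _ , Z∈Y , Y∈ with ∈-tabulate⁻ {f = Fs} Y∈
    ...   | i , refl = inj₂ (i , Z∈Y)

    ⊆-topF : ∀ {Z} → Z ∈L F → Z ⊆ a
    ⊆-topF Z∈ with ∈F⁻ Z∈
    ... | inj₁ refl = λ x∈ → x∈
    ... | inj₂ (i , Z∈i) = λ x∈ → sub i (H.⊆-top i Z∈i x∈)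

    nonemptyF : ∀ {Z} → Z ∈L F → Nonempty Z
    nonemptyF Z∈ with ∈F⁻ Z∈
    ... | inj₁ refl = a-nonempty
    ... | inj₂ (i , Z∈i) = H.nonempty i Z∈i

    laminarF : ∀ {X Y} → X ∈L F → Y ∈L F → X ⊆ Y ⊎ Y ⊆ X ⊎ Disjoint X Y
    laminarF X∈ Y∈ with ∈F⁻ X∈ | ∈F⁻ Y∈
    ... | inj₁ refl | _ = inj₂ (inj₁ (⊆-topF Y∈))
    ... | inj₂ _ | inj₁ refl = inj₁ (⊆-topF X∈)
    ... | inj₂ (i , X∈i) | inj₂ (j , Y∈j) with i ≟F j
    ...   | yes refl = H.laminar i X∈i Y∈j
    ...   | no i≢j = inj₂ (inj₂ λ x∈X x∈Y → i≢j (disjoint (H.⊆-top i X∈i x∈X) (H.⊆-top j Y∈j x∈Y)))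

    covers-top : ∀ {U} → Covers F U a → ∃ λ i → U ≡ B i
    covers-top (U∈ , _ , (U⊆a , U≢a) , maximal) with ∈F⁻ U∈
    ... | inj₁ U≡a = ⊥-elim (U≢a U≡a)
    ... | inj₂ (i , U∈i) with B i ≟S _
    ...   | yes Bi≡U = i , sym Bi≡U
    ...   | no Bi≢U = ⊥-elim (maximal (B i) (∈F⁺ (H.top∈ i))
                        ((H.⊆-top i U∈i , λ U≡Bi → Bi≢U (sym U≡Bi)) , (sub i , B≢a i)))

    covers-inner : ∀ {i U P} → P ∈L Fs i → Covers F U P → Covers (Fs i) U P
    covers-inner {i} P∈i (U∈ , _ , (U⊆P , U≢P) , maximal) with ∈F⁻ U∈
    ... | inj₁ refl = ⊥-elim (B≢a i (⊆-antisym (sub i) (λ x∈a → H.⊆-top i P∈i (U⊆P x∈a))))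
    ... | inj₂ (j , U∈j) with i ≟F j
    ...   | yes refl = U∈j , P∈i , (U⊆P , U≢P) , λ Z Z∈ → maximal Z (∈F⁺ Z∈)
    ...   | no i≢j = let (x , x∈U) = H.nonempty j U∈j
                     in ⊥-elim (i≢j (disjoint (H.⊆-top i P∈i (U⊆P x∈U)) (H.⊆-top j U∈j x∈U)))

    top-colored : ChildrenColored F a
    top-colored = let (Δ , ∣Δ∣≤2 , B-Δ) = B-2partition in Δ , ∣Δ∣≤2 , colored B-Δ
      where
      colored : ∀ {Δ} → IsΔPartition col Δ B → ∀ {U V} → Covers F U a → Covers F V a → U ≢ V →
                Σ C λ c → c ∈L Δ × (∀ {x y} → x ∈ U → y ∈ V → col x y ≡ c)
      colored B-Δ U-covers V-covers U≢V with covers-top U-covers | covers-top V-covers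
      ... | i , refl | j , refl with i ≟F j
      ...   | yes refl = ⊥-elim (U≢V refl)
      ...   | no i≢j =
        let (x₀ , x₀∈i) = nonempty i
            (y₀ , y₀∈j) = nonempty j
        in col x₀ y₀ , B-Δ i j x₀ y₀ i≢j x₀∈i y₀∈j ,
           λ x∈i y∈j → B-homogeneous i j _ x₀ _ y₀ i≢j x∈i x₀∈i y∈j y₀∈j

    children-coloredF : ∀ {P} → P ∈L F → ChildrenColored F P
    children-coloredF {P} P∈ with P ≟S a | ∈F⁻ P∈
    ... | yes refl | _ = top-colored
    ... | no P≢a | inj₁ P≡a = ⊥-elim (P≢a P≡a)
    ... | no _ | inj₂ (i , P∈i) =
      let (Δ , ∣Δ∣≤2 , colored) = H.children-colored i P∈i
      in Δ , ∣Δ∣≤2 , λ U-covers V-covers →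
           colored (covers-inner P∈i U-covers) (covers-inner P∈i V-covers)

    hierarchy : Hierarchy a F
    hierarchy = record
      { nonempty = nonemptyF
      ; ⊆-top = ⊆-topF
      ; top∈ = here refl
      ; singleton∈ = λ x∈a → let (i , x∈i) = cover x∈a in ∈F⁺ (H.singleton∈ i x∈i)
      ; laminar = laminarF
      ; children-colored = children-coloredF
      }

  hereditary⇒hierarchy : ∀ {a} → Hereditary2Clique col a → ∃ (Hierarchy a)
  hereditary⇒hierarchy (singleton x) = _ , hierarchy-singleton x
  hereditary⇒hierarchy (split a k B a-nonempty B-partition B-homogeneous B-2partition B-hereditary)
    with any? (λ i → B i ≟S a)
  ... | yes (i , Bi≡a) = subst (λ b → ∃ (Hierarchy b)) Bi≡a (hereditary⇒hierarchy (B-hereditary i))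
  ... | no Bi≢a = _ , Split.hierarchy a k B a-nonempty B-partition B-homogeneous B-2partition
                        (λ i → proj₁ (hereditary⇒hierarchy (B-hereditary i)))
                        (λ i → proj₂ (hereditary⇒hierarchy (B-hereditary i)))
                        (λ i Bi≡a → Bi≢a (i , Bi≡a))

  module HierarchyToTree (col-symmetric : Symmetric col) {a : Subset n} {F : List (Subset n)}
                         (H : Hierarchy a F) where
    open Hierarchy H

    nodes : List (Subset n)
    nodes = deduplicate _≟S_ F

    m : ℕ
    m = length nodes

    node : Fin m → Subset n
    node = lookup nodes

    node-injective : ∀ {s t} → node s ≡ node t → s ≡ t
    node-injective = Unique⇒lookup-injective (deduplicate-! _≟S_ F)

    node∈F : ∀ t → node t ∈L F
    node∈F t = ∈-deduplicate⁻ _≟S_ F (∈-lookup t)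

    nodeOf : ∀ {X} → X ∈L F → Fin m
    nodeOf X∈ = index (∈-deduplicate⁺ _≟S_ X∈)

    node-nodeOf : ∀ {X} (X∈ : X ∈L F) → node (nodeOf X∈) ≡ X
    node-nodeOf X∈ = sym (lookup-index (∈-deduplicate⁺ _≟S_ X∈))

    le : Fin m → Fin m → Bool
    le s t = isYes (node s ⊆? node t)

    open TreeNotions le

    ≼⇒⊆ : ∀ {s t} → s ≼ t → node s ⊆ node t
    ≼⇒⊆ {s} {t} = toWitness {a? = node s ⊆? node t}

    ⊆⇒≼ : ∀ {s t} → node s ⊆ node t → s ≼ t
    ⊆⇒≼ {s} {t} = fromWitness {a? = node s ⊆? node t}

    ≼-top : ∀ s → s ≼ nodeOf top∈
    ≼-top s = ⊆⇒≼ (subst (node s ⊆_) (sym (node-nodeOf top∈)) (⊆-top (node∈F s)))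

    -- Laminarity: two nodes with a common lower bound are nonempty-intersecting, hence nested.
    isTree : IsTree
    isTree = record
      { refl′ = λ _ → ⊆⇒≼ (λ x∈ → x∈)
      ; antisym = λ _ _ s≼t t≼s → node-injective (⊆-antisym (≼⇒⊆ s≼t) (≼⇒⊆ t≼s))
      ; trans′ = λ _ _ _ s≼t t≼u → ⊆⇒≼ (λ x∈ → ≼⇒⊆ t≼u (≼⇒⊆ s≼t x∈))
      ; upper = λ s t _ → nodeOf top∈ , ≼-top s , ≼-top t
      ; noLower = noLower
      }
      where
      noLower : ∀ s t → Unrelated s t → ¬ (∃ λ u → u ≼ s × u ≼ t)
      noLower s t (s⋠t , t⋠s) (u , u≼s , u≼t) with laminar (node∈F s) (node∈F t)
      ... | inj₁ s⊆t = s⋠t (⊆⇒≼ s⊆t)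
      ... | inj₂ (inj₁ t⊆s) = t⋠s (⊆⇒≼ t⊆s)
      ... | inj₂ (inj₂ s∩t≡∅) = let (x , x∈u) = nonempty (node∈F u) in s∩t≡∅ (≼⇒⊆ u≼s x∈u) (≼⇒⊆ u≼t x∈u)

    open IsTree isTree
    open TreeProperties isTree

    child⇒covers : ∀ {u p} → Child u p → Covers F (node u) (node p)
    child⇒covers {u} {p} ((u≼p , u≢p) , no-between) =
      node∈F u , node∈F p , (≼⇒⊆ u≼p , λ eq → u≢p (node-injective eq)) , maximal
      where
      maximal : ∀ Z → Z ∈L F → ¬ (node u ⊊ Z × Z ⊊ node p)
      maximal Z Z∈ rewrite sym (node-nodeOf Z∈) = λ ((u⊆z , u≢z) , (z⊆p , z≢p)) →
        no-between (nodeOf Z∈) ((⊆⇒≼ u⊆z , λ { refl → u≢z refl }) , (⊆⇒≼ z⊆p , λ { refl → z≢p refl }))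

    point : Fin m → Fin n
    point t = proj₁ (nonempty (node∈F t))

    point∈ : ∀ t → point t ∈ node t
    point∈ t = proj₂ (nonempty (node∈F t))

    hat : Fin m → Fin m → C
    hat u v = col (point u) (point v)

    children-colored-at : ∀ {u v p} → Child u p → Child v p → u ≢ v →
                        Σ C λ c → c ∈L proj₁ (children-colored (node∈F p)) ×
                                   (∀ {x y} → x ∈ node u → y ∈ node v → col x y ≡ c)
    children-colored-at {p = p} u-child v-child u≢v =
      proj₂ (proj₂ (children-colored (node∈F p)))
            (child⇒covers u-child) (child⇒covers v-child) (λ eq → u≢v (node-injective eq))

    is2Coloring : Is2Coloring hat
    is2Coloring = record
      { symm = λ u v _ → col-symmetric (point u) (point v)
      ; two = λ t _ → let (Δ , ∣Δ∣≤2 , _) = children-colored (node∈F t)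
                      in Δ , ∣Δ∣≤2 , λ u v u-child v-child u≢v →
                           let (c , c∈Δ , col≡c) = children-colored-at u-child v-child u≢v
                           in subst (_∈L Δ) (sym (col≡c (point∈ u) (point∈ v))) c∈Δ
      }

    -- φ is irrelevant outside a; there it is sent to the root.
    φ : Fin n → Fin m
    φ x with x ∈? a
    ... | yes x∈a = nodeOf (singleton∈ x∈a)
    ... | no _ = nodeOf top∈

    node-φ : ∀ {x} → x ∈ a → node (φ x) ≡ ⁅ x ⁆
    node-φ {x} x∈a with x ∈? a
    ... | yes x∈a = node-nodeOf (singleton∈ x∈a)
    ... | no x∉a = ⊥-elim (x∉a x∈a)

    x∈φx : ∀ {x} → x ∈ a → x ∈ node (φ x)
    x∈φx {x} x∈a = subst (x ∈_) (sym (node-φ x∈a)) (x∈⁅x⁆ x)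

    ∈⇒φ≼ : ∀ {x t} → x ∈ a → x ∈ node t → φ x ≼ t
    ∈⇒φ≼ {x} x∈a x∈t = ⊆⇒≼ λ y∈ → subst (_∈ _) (sym (x∈⁅y⁆⇒x≡y _ (subst (_ ∈_) (node-φ x∈a) y∈))) x∈t

    φ-leaf : ∀ x → x ∈ a → Leaf (φ x)
    φ-leaf x x∈a s ((s≼φx , s≢φx) , _) = s≢φx (antisym s (φ x) s≼φx (∈⇒φ≼ x∈a x∈s))
      where
      y∈s = point∈ s
      x∈s : x ∈ node s
      x∈s = subst (_∈ node s) (x∈⁅y⁆⇒x≡y _ (subst (_ ∈_) (node-φ x∈a) (≼⇒⊆ s≼φx y∈s))) y∈s

    φ-injective : ∀ x y → x ∈ a → y ∈ a → φ x ≡ φ y → x ≡ y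
    φ-injective x y x∈a y∈a φx≡φy =
      x∈⁅y⁆⇒x≡y y (subst (x ∈_) ⁅x⁆≡⁅y⁆ (x∈⁅x⁆ x))
      where
      ⁅x⁆≡⁅y⁆ : ⁅ x ⁆ ≡ ⁅ y ⁆
      ⁅x⁆≡⁅y⁆ = trans (sym (node-φ x∈a)) (trans (cong node φx≡φy) (node-φ y∈a))

    φ-surjective : ∀ t → Leaf t → ∃ λ x → x ∈ a × φ x ≡ t
    φ-surjective t t-leaf with φ (point t) ≟F t
    ... | yes φx≡t = point t , ⊆-top (node∈F t) (point∈ t) , φx≡t
    ... | no φx≢t = ⊥-elim (leaf-minimal t-leaf (∈⇒φ≼ (⊆-top (node∈F t) (point∈ t)) (point∈ t) , φx≢t))

    φ-preserves : ∀ x y → x ∈ a → y ∈ a → x ≢ y → LeafColor hat (φ x) (φ y) (col x y)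
    φ-preserves x y x∈a y∈a _ u v ((u⋠v , _) , p , u-child , v-child) φx≼u φy≼v =
      let (c , _ , col≡c) = children-colored-at u-child v-child (λ { refl → u⋠v (refl′ u) })
      in trans (col≡c (≼⇒⊆ φx≼u (x∈φx x∈a)) (≼⇒⊆ φy≼v (x∈φx y∈a))) (sym (col≡c (point∈ u) (point∈ v)))

    tree2Clique : Tree2Clique col a
    tree2Clique = m , le , hat , φ , record
      { isTree = isTree
      ; is2Col = is2Coloring
      ; toLeaf = φ-leaf
      ; injective = φ-injective
      ; surjective = φ-surjective
      ; preserves = φ-preserves
      }

proposition6 : ∀ {n : ℕ} {C : Set} (col : Fin n → Fin n → C) → Symmetric col →
    (a : Subset n) → Nonempty a →
    (Tree2Clique col a → Hereditary2Clique col a) × (Hereditary2Clique col a → Tree2Clique col a)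
proposition6 col col-symmetric a a-nonempty =
  (λ (_ , _ , _ , _ , W) → TreeToHereditary.hereditary W a-nonempty) ,
  (λ a-hereditary → let (_ , H) = hereditary⇒hierarchy a-hereditary
                    in HierarchyToTree.tree2Clique col-symmetric H)
  where open Hierarchies col
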